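{- (Relevant Reasoning.) For every relevant modal logic $\mathsf{L}$ (determined by a set $\Phi$ of frame conditions from the table below), every $n>0$ and all formulas $\varphi_1,\dots,\varphi_n,\psi$: if $\varphi_1\land\dots\land\varphi_n\to\psi$ is provable in the axiom system $\mathsf{L}$, then $\Box\varphi_1\land\dots\land\Box\varphi_n\to\Box\psi$ is provable in the axiom system $\mathsf{CL}$.
   Context: Language: a countable set $Pr$ of propositional variables, binary connectives $\land,\lor,\to$ and unary connectives $\neg,\Box,\Box_L$; $\varphi\leftrightarrow\psi:=(\varphi\to\psi)\land(\psi\to\varphi)$. Frame conditions and corresponding axioms/rules (conditions on a ternary $R$, binary $Q$, unary $*$, order $\le$, distinguished set $L$; $Rstuv:=\exists x(Rstx\,\&\,Rxuv)$, $Rs(tu)v:=\exists x(Rtux\,\&\,Rsxv)$, $RQstu:=\exists x(Rstx\,\&\,Qxu)$, $QRstu:=\exists x(Qsx\,\&\,Rxtu)$): (DN) $s^{**}=s$ / $p\leftrightarrow\neg\neg p$; (Cp) $Rstu\Rightarrow Rsu^*t^*$ / $(p\to q)\to(\neg q\to\neg p)$; (WB) $Rstu\Rightarrow Rs(st)u$ / $((p\to q)\land(q\to r))\to(p\to r)$; (X) $s\in L\Rightarrow s^*\le s$ / $p\lor\neg p$; (Rd) $Rss^*s$ / $(p\to\neg p)\to\neg p$; (B) $Rstuv\Rightarrow Rs(tu)v$ / $(p\to q)\to((r\to p)\to(r\to q))$; (CB) $Rstuv\Rightarrow Rt(su)v$ / $(p\to q)\to((q\to r)\to(p\to r))$; (W)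 $Rstu\Rightarrow Rsttu$ / $(p\to(p\to q))\to(p\to q)$; (C) $Rstuv\Rightarrow Rsutv$ / $(p\to(q\to r))\to(q\to(p\to r))$; (M) $Rstu\Rightarrow(s\le u$ or $t\le u)$ / $p\to(p\to p)$; (ER) $\exists x(x\in L\,\&\,Rsxs)$ / rule: from $\varphi$ infer $(\varphi\to\psi)\to\psi$; (Nec) $(x\in L\,\&\,Qxs)\Rightarrow s\in L$ / rule: from $\varphi$ infer $\Box\varphi$; ($\Box$K) $RQstu\Rightarrow\exists x(Qtx\,\&\,QRsxu)$ / $\Box(p\to q)\to(\Box p\to\Box q)$; ($\Box$T) $Qss$ / $\Box p\to p$; ($\Box$D) $\exists x(Qsx^*\,\&\,Qs^*x)$ / $\Box\neg p\to\neg\Box p$; ($\Box$4) $(Qst\,\&\,Qtu)\Rightarrow Qsu$ / $\Box p\to\Box\Box p$; ($\Box$5) $(Qs^*u\,\&\,Qst)\Rightarrow Qt^*u$ / $\neg\Box p\to\Box\neg\Box p$. The axiom system $\mathsf{L}$ is $\mathsf{BM.C}$ plus the axioms/rules corresponding to the chosen set $\Phi$, where $\mathsf{BM.C}$ has axioms $p\to p$; $\neg(p\land q)\to(\neg p\lor\neg q)$; $(\neg p\land\neg q)\to\neg(p\lor q)$; $(p\land q)\to p$; $(p\land q)\to q$; $p\to(p\lor q)$; $q\to(p\lor q)$; $((p\to q)\land(p\to r))\to(p\to(q\land r))$; $((p\to r)\land(q\to r))\to((p\lor q)\to r)$; $(p\land(q\lor r))\to((p\land q)\lor(p\land r))$;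 $(\Box p\land\Box q)\to\Box(p\land q)$; $(\Box_Lp\land\Box_Lq)\to\Box_L(p\land q)$; rules: uniform substitution, modus ponens, adjunction ($\varphi,\psi/\varphi\land\psi$), affixing ($\varphi'\to\varphi,\ \psi\to\psi'/(\varphi\to\psi)\to(\varphi'\to\psi')$), contraposition ($\varphi\to\psi/\neg\psi\to\neg\varphi$), $\Box$-monotonicity ($\varphi\to\psi/\Box\varphi\to\Box\psi$), $\Box_L$-monotonicity ($\varphi\to\psi/\Box_L\varphi\to\Box_L\psi$). The axiom system $\mathsf{CL}$ consists of: classical propositional logic (all substitution instances over the full language, $\neg,\to,\land,\lor$ read classically), modus ponens, uniform substitution; an axiom $\Box_L\varphi$ for each axiom $\varphi$ of $\mathsf{L}$; for each inference rule $\varphi_1,\dots,\varphi_n/\psi$ of $\mathsf{L}$, the rule $\Box_L\varphi_1,\dots,\Box_L\varphi_n/\Box_L\psi$; and the Bridge Rule: from $\Box_L(\varphi\to\psi)$ infer $\varphi\to\psi$. -}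

module Defs where

open import Data.Nat using (ℕ; suc)
open import Data.Bool using (Bool; true; false; _∧_; _∨_; not)
open import Data.Vec using (Vec; []; _∷_)
open import Relation.Binary.PropositionalEquality using (_≡_)

infixr 6 _∧′_
infixr 5 _∨′_
infixr 4 _⇒_
infix 3 _⇔_
infix 8 ¬′_ □_ □L_

data Fm : Set where
  var  : ℕ → Fm
  _∧′_ : Fm → Fm → Fm
  _∨′_ : Fm → Fm → Fm
  _⇒_  : Fm → Fm → Fm
  ¬′_  : Fm → Fm
  □_   : Fm → Fm
  □L_  : Fm → Fm

_⇔_ : Fm → Fm → Fm
φ ⇔ ψ = (φ ⇒ ψ) ∧′ (ψ ⇒ φ)

p q r : Fm
p = var 0
q = var 1
r = var 2

sub : (ℕ → Fm) → Fm → Fm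
sub σ (var n)  = σ n
sub σ (φ ∧′ ψ) = sub σ φ ∧′ sub σ ψ
sub σ (φ ∨′ ψ) = sub σ φ ∨′ sub σ ψ
sub σ (φ ⇒ ψ)  = sub σ φ ⇒ sub σ ψ
sub σ (¬′ φ)   = ¬′ sub σ φ
sub σ (□ φ)    = □ sub σ φ
sub σ (□L φ)   = □L sub σ φ

⋀ : ∀ {n} → Vec Fm (suc n) → Fm
⋀ (φ ∷ [])     = φ
⋀ (φ ∷ ψ ∷ φs) = φ ∧′ ⋀ (ψ ∷ φs)

□s : ∀ {n} → Vec Fm n → Vec Fm n
□s []       = []
□s (φ ∷ φs) = □ φ ∷ □s φs

-- Frame conditions (the table); a relevant modal logic is determined
-- by an arbitrary set Φ of them, represented as a predicate on Cond.

data Cond : Set where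
  DN Cp WB X Rd B CB W C M ER Nec □K □T □D □4 □5 : Cond

CondSet : Set₁
CondSet = Cond → Set

data BMCAx : Fm → Set where
  a-id     : BMCAx (p ⇒ p)
  a-dm1    : BMCAx (¬′ (p ∧′ q) ⇒ (¬′ p ∨′ ¬′ q))
  a-dm2    : BMCAx ((¬′ p ∧′ ¬′ q) ⇒ ¬′ (p ∨′ q))
  a-∧e1    : BMCAx ((p ∧′ q) ⇒ p)
  a-∧e2    : BMCAx ((p ∧′ q) ⇒ q)
  a-∨i1    : BMCAx (p ⇒ (p ∨′ q))
  a-∨i2    : BMCAx (q ⇒ (p ∨′ q))
  a-∧i     : BMCAx (((p ⇒ q) ∧′ (p ⇒ r)) ⇒ (p ⇒ (q ∧′ r)))
  a-∨e     : BMCAx (((p ⇒ r) ∧′ (q ⇒ r)) ⇒ ((p ∨′ q) ⇒ r))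
  a-dist   : BMCAx ((p ∧′ (q ∨′ r)) ⇒ ((p ∧′ q) ∨′ (p ∧′ r)))
  a-□C     : BMCAx ((□ p ∧′ □ q) ⇒ □ (p ∧′ q))
  a-□LC    : BMCAx ((□L p ∧′ □L q) ⇒ □L (p ∧′ q))

-- Axioms corresponding to frame conditions (ER and Nec give rules instead)
data CondAx : Cond → Fm → Set where
  ax-DN : CondAx DN (p ⇔ ¬′ ¬′ p)
  ax-Cp : CondAx Cp ((p ⇒ q) ⇒ (¬′ q ⇒ ¬′ p))
  ax-WB : CondAx WB (((p ⇒ q) ∧′ (q ⇒ r)) ⇒ (p ⇒ r))
  ax-X  : CondAx X  (p ∨′ ¬′ p)
  ax-Rd : CondAx Rd ((p ⇒ ¬′ p) ⇒ ¬′ p)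
  ax-B  : CondAx B  ((p ⇒ q) ⇒ ((r ⇒ p) ⇒ (r ⇒ q)))
  ax-CB : CondAx CB ((p ⇒ q) ⇒ ((q ⇒ r) ⇒ (p ⇒ r)))
  ax-W  : CondAx W  ((p ⇒ (p ⇒ q)) ⇒ (p ⇒ q))
  ax-C  : CondAx C  ((p ⇒ (q ⇒ r)) ⇒ (q ⇒ (p ⇒ r)))
  ax-M  : CondAx M  (p ⇒ (p ⇒ p))
  ax-□K : CondAx □K (□ (p ⇒ q) ⇒ (□ p ⇒ □ q))
  ax-□T : CondAx □T (□ p ⇒ p)
  ax-□D : CondAx □D (□ (¬′ p) ⇒ ¬′ □ p)
  ax-□4 : CondAx □4 (□ p ⇒ □ □ p)
  ax-□5 : CondAx □5 (¬′ □ p ⇒ □ (¬′ □ p))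

data LAx (Φ : CondSet) : Fm → Set where
  bmc  : ∀ {φ} → BMCAx φ → LAx Φ φ
  cond : ∀ {c φ} → Φ c → CondAx c φ → LAx Φ φ

data ⊢L (Φ : CondSet) : Fm → Set where
  ax     : ∀ {φ} → LAx Φ φ → ⊢L Φ φ
  us     : ∀ {φ} (σ : ℕ → Fm) → ⊢L Φ φ → ⊢L Φ (sub σ φ)
  mp     : ∀ {φ ψ} → ⊢L Φ φ → ⊢L Φ (φ ⇒ ψ) → ⊢L Φ ψ
  adj    : ∀ {φ ψ} → ⊢L Φ φ → ⊢L Φ ψ → ⊢L Φ (φ ∧′ ψ)
  affix  : ∀ {φ φ′ ψ ψ′} → ⊢L Φ (φ′ ⇒ φ) → ⊢L Φ (ψ ⇒ ψ′)
         → ⊢L Φ ((φ ⇒ ψ) ⇒ (φ′ ⇒ ψ′))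
  contra : ∀ {φ ψ} → ⊢L Φ (φ ⇒ ψ) → ⊢L Φ (¬′ ψ ⇒ ¬′ φ)
  □mono  : ∀ {φ ψ} → ⊢L Φ (φ ⇒ ψ) → ⊢L Φ (□ φ ⇒ □ ψ)
  □Lmono : ∀ {φ ψ} → ⊢L Φ (φ ⇒ ψ) → ⊢L Φ (□L φ ⇒ □L ψ)
  er     : ∀ {φ} → Φ ER → (ψ : Fm) → ⊢L Φ φ → ⊢L Φ ((φ ⇒ ψ) ⇒ ψ)
  nec    : ∀ {φ} → Φ Nec → ⊢L Φ φ → ⊢L Φ (□ φ)

-- Classical evaluation over the full language: ¬, →, ∧, ∨ are read
-- classically, and formulas □ φ, □L φ (as well as variables) are atoms.
-- A formula is a classical tautology iff it is true under every
-- assignment of truth values to these atoms; this is exactly the set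
-- of substitution instances (over the full language) of propositional
-- tautologies.

_⊃_ : Bool → Bool → Bool
a ⊃ b = not a ∨ b

eval : (Fm → Bool) → Fm → Bool
eval v (var n)  = v (var n)
eval v (φ ∧′ ψ) = eval v φ ∧ eval v ψ
eval v (φ ∨′ ψ) = eval v φ ∨ eval v ψ
eval v (φ ⇒ ψ)  = eval v φ ⊃ eval v ψ
eval v (¬′ φ)   = not (eval v φ)
eval v (□ φ)    = v (□ φ)
eval v (□L φ)   = v (□L φ)

Taut : Fm → Set
Taut φ = (v : Fm → Bool) → eval v φ ≡ true

data ⊢CL (Φ : CondSet) : Fm → Set where
  taut    : ∀ {φ} → Taut φ → ⊢CL Φ φ
  mp      : ∀ {φ ψ} → ⊢CL Φ φ → ⊢CL Φ (φ ⇒ ψ) → ⊢CL Φ ψ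
  us      : ∀ {φ} (σ : ℕ → Fm) → ⊢CL Φ φ → ⊢CL Φ (sub σ φ)
  axL     : ∀ {φ} → LAx Φ φ → ⊢CL Φ (□L φ)
  L-us     : ∀ {φ} (σ : ℕ → Fm) → ⊢CL Φ (□L φ) → ⊢CL Φ (□L (sub σ φ))
  L-mp     : ∀ {φ ψ} → ⊢CL Φ (□L φ) → ⊢CL Φ (□L (φ ⇒ ψ)) → ⊢CL Φ (□L ψ)
  L-adj    : ∀ {φ ψ} → ⊢CL Φ (□L φ) → ⊢CL Φ (□L ψ) → ⊢CL Φ (□L (φ ∧′ ψ))
  L-affix  : ∀ {φ φ′ ψ ψ′} → ⊢CL Φ (□L (φ′ ⇒ φ)) → ⊢CL Φ (□L (ψ ⇒ ψ′))
           → ⊢CL Φ (□L ((φ ⇒ ψ) ⇒ (φ′ ⇒ ψ′)))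
  L-contra : ∀ {φ ψ} → ⊢CL Φ (□L (φ ⇒ ψ)) → ⊢CL Φ (□L (¬′ ψ ⇒ ¬′ φ))
  L-□mono  : ∀ {φ ψ} → ⊢CL Φ (□L (φ ⇒ ψ)) → ⊢CL Φ (□L (□ φ ⇒ □ ψ))
  L-□Lmono : ∀ {φ ψ} → ⊢CL Φ (□L (φ ⇒ ψ)) → ⊢CL Φ (□L (□L φ ⇒ □L ψ))
  L-er     : ∀ {φ} → Φ ER → (ψ : Fm) → ⊢CL Φ (□L φ) → ⊢CL Φ (□L ((φ ⇒ ψ) ⇒ ψ))
  L-nec    : ∀ {φ} → Φ Nec → ⊢CL Φ (□L φ) → ⊢CL Φ (□L (□ φ))
  bridge  : ∀ {φ ψ} → ⊢CL Φ (□L (φ ⇒ ψ)) → ⊢CL Φ (φ ⇒ ψ)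

{-# OPTIONS --safe #-}
module Submission where

-- In L the axiom □p ∧ □q → □(p ∧ q) gives □φ₁ ∧ … ∧ □φₙ → □(φ₁ ∧ … ∧ φₙ),
-- and □-monotonicity turns the hypothesis into □(φ₁ ∧ … ∧ φₙ) → □ψ, so the
-- implication ⋀ □φᵢ → □ψ is a theorem of L. Every L-derivation replays
-- under □L in CL, and the Bridge Rule removes □L from an implication.

open import Defs
open import Data.Nat using (ℕ; suc; zero)
open import Data.Vec using (Vec; []; _∷_)

⟨_,_,_⟩ : Fm → Fm → Fm → ℕ → Fm
⟨ a , b , c ⟩ zero          = a
⟨ a , b , c ⟩ (suc zero)    = b
⟨ a , b , c ⟩ (suc (suc _)) = c

module _ {Φ : CondSet} where

  ⊢L⇒⊢CL-□L : ∀ {φ} → ⊢L Φ φ → ⊢CL Φ (□L φ)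
  ⊢L⇒⊢CL-□L (ax a)      = axL a
  ⊢L⇒⊢CL-□L (us σ d)    = L-us σ (⊢L⇒⊢CL-□L d)
  ⊢L⇒⊢CL-□L (mp d e)    = L-mp (⊢L⇒⊢CL-□L d) (⊢L⇒⊢CL-□L e)
  ⊢L⇒⊢CL-□L (adj d e)   = L-adj (⊢L⇒⊢CL-□L d) (⊢L⇒⊢CL-□L e)
  ⊢L⇒⊢CL-□L (affix d e) = L-affix (⊢L⇒⊢CL-□L d) (⊢L⇒⊢CL-□L e)
  ⊢L⇒⊢CL-□L (contra d)  = L-contra (⊢L⇒⊢CL-□L d)
  ⊢L⇒⊢CL-□L (□mono d)   = L-□mono (⊢L⇒⊢CL-□L d)
  ⊢L⇒⊢CL-□L (□Lmono d)  = L-□Lmono (⊢L⇒⊢CL-□L d)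
  ⊢L⇒⊢CL-□L (er c ψ d)  = L-er c ψ (⊢L⇒⊢CL-□L d)
  ⊢L⇒⊢CL-□L (nec c d)   = L-nec c (⊢L⇒⊢CL-□L d)

  ⊢L⇒⊢CL-⇒ : ∀ {φ ψ} → ⊢L Φ (φ ⇒ ψ) → ⊢CL Φ (φ ⇒ ψ)
  ⊢L⇒⊢CL-⇒ d = bridge (⊢L⇒⊢CL-□L d)

  ⇒-refl : ∀ a → ⊢L Φ (a ⇒ a)
  ⇒-refl a = us ⟨ a , a , a ⟩ (ax (bmc a-id))

  -- affixing d and e gives (b ⇒ b) ⇒ (a ⇒ c); detach it with p ⇒ p
  ⇒-trans : ∀ {a b c} → ⊢L Φ (a ⇒ b) → ⊢L Φ (b ⇒ c) → ⊢L Φ (a ⇒ c)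
  ⇒-trans {b = b} d e = mp (⇒-refl b) (affix d e)

  ∧-elimˡ : ∀ a b → ⊢L Φ ((a ∧′ b) ⇒ a)
  ∧-elimˡ a b = us ⟨ a , b , b ⟩ (ax (bmc a-∧e1))

  ∧-elimʳ : ∀ a b → ⊢L Φ ((a ∧′ b) ⇒ b)
  ∧-elimʳ a b = us ⟨ a , b , b ⟩ (ax (bmc a-∧e2))

  ⇒-∧-intro : ∀ {a b c} → ⊢L Φ (a ⇒ b) → ⊢L Φ (a ⇒ c) → ⊢L Φ (a ⇒ (b ∧′ c))
  ⇒-∧-intro {a} {b} {c} d e = mp (adj d e) (us ⟨ a , b , c ⟩ (ax (bmc a-∧i)))

  ∧-monoʳ : ∀ a {b c} → ⊢L Φ (b ⇒ c) → ⊢L Φ ((a ∧′ b) ⇒ (a ∧′ c))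
  ∧-monoʳ a {b} d = ⇒-∧-intro (∧-elimˡ a b) (⇒-trans (∧-elimʳ a b) d)

  □-∧ : ∀ a b → ⊢L Φ ((□ a ∧′ □ b) ⇒ □ (a ∧′ b))
  □-∧ a b = us ⟨ a , b , b ⟩ (ax (bmc a-□C))

  ⋀□s⇒□⋀ : ∀ {n} (φs : Vec Fm (suc n)) → ⊢L Φ (⋀ (□s φs) ⇒ □ ⋀ φs)
  ⋀□s⇒□⋀ (φ ∷ [])     = ⇒-refl (□ φ)
  ⋀□s⇒□⋀ (φ ∷ ψ ∷ φs) =
    ⇒-trans (∧-monoʳ (□ φ) (⋀□s⇒□⋀ (ψ ∷ φs))) (□-∧ φ (⋀ (ψ ∷ φs)))

proposition5p5 : (Φ : CondSet) (n : ℕ) (φs : Vec Fm (suc n)) (ψ : Fm)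
    → ⊢L Φ (⋀ φs ⇒ ψ) → ⊢CL Φ (⋀ (□s φs) ⇒ □ ψ)
proposition5p5 Φ n φs ψ d = ⊢L⇒⊢CL-⇒ (⇒-trans (⋀□s⇒□⋀ φs) (□mono d))
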